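{- Let $G$ and $H$ be finite simple graphs with $Q(G;x,y)=Q(H;x,y)$. Then $c(G)=c(H)$; that is, the connectivity of a graph is determined by its subgraph component polynomial.
   Context: For a finite simple graph $G=(V,E)$ and $X\subseteq V$, $G[X]$ is the induced subgraph on $X$ and $k(G[X])$ its number of connected components (with $k$ of the empty graph equal to $0$). The subgraph component polynomial is $Q(G;x,y)=\sum_{X\subseteq V} x^{|X|}y^{k(G[X])}$. The connectivity $c(G)$ of a non-complete graph is the minimum cardinality of a vertex set whose removal leaves a disconnected graph; by convention $c(K_n)=n-1$. -}

module Defs where

open import Data.Bool using (Bool; true; false; _∧_; _∨_; not; if_then_else_)
open import Data.Nat using (ℕ; zero; suc; _∸_; _≤_; _≡ᵇ_)
open import Data.Fin using (Fin; _<?_)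
open import Data.Fin.Subset using (Subset; inside; outside; ∣_∣; ∁)
open import Data.Vec using (Vec; []; _∷_; lookup; tabulate)
open import Data.List using (List; []; _∷_; map; _++_; filter; length; allFin)
open import Data.List.Relation.Unary.Any using (any?)
open import Data.Empty using (⊥)
open import Data.Product using (Σ; _×_; _,_)
open import Relation.Nullary.Decidable using (⌊_⌋)
open import Relation.Binary.PropositionalEquality using (_≡_; _≢_)

record Graph (n : ℕ) : Set where
  field
    adj    : Fin n → Fin n → Bool
    sym    : ∀ u v → adj u v ≡ adj v u
    irrefl : ∀ v → adj v v ≡ false
open Graph public

_∈ᵇ_ : ∀ {n} → Fin n → Subset n → Bool
v ∈ᵇ X with lookup X v
... | inside  = true
... | outside = false

allSubsets : (n : ℕ) → List (Subset n)
allSubsets zero    = [] ∷ []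
allSubsets (suc n) = map (inside ∷_) (allSubsets n) ++ map (outside ∷_) (allSubsets n)

anyV : ∀ {n} → (Fin n → Bool) → Bool
anyV {n} p = Data.List.foldr _∨_ false (map p (allFin n))

reach : ∀ {n} → Graph n → Subset n → Fin n → ℕ → Fin n → Bool
reach G X u zero    v = (u ∈ᵇ X) ∧ ⌊ u Data.Fin.≟ v ⌋
reach G X u (suc t) v =
  reach G X u t v ∨ ((v ∈ᵇ X) ∧ anyV (λ w → reach G X u t w ∧ adj G w v))

-- u and v lie in the same connected component of G[X]
-- (walks of length ≤ n suffice on n vertices).
connectedIn : ∀ {n} → Graph n → Subset n → Fin n → Fin n → Bool
connectedIn {n} G X u v = reach G X u n v

-- k(G[X]) : number of connected components of G[X], counted as the number of
-- vertices v ∈ X that are the least vertex (in the order of Fin n) of their component.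
-- k of the empty graph is 0.
components : ∀ {n} → Graph n → Subset n → ℕ
components {n} G X =
  length (filter (λ v → Data.Bool._≟_ ((v ∈ᵇ X) ∧ not (anyV (λ w → ⌊ w <? v ⌋ ∧ connectedIn G X w v))) true)
                 (allFin n))

-- Coefficient of x^i y^j in Q(G;x,y) = Σ_{X ⊆ V} x^{|X|} y^{k(G[X])}:
-- the number of vertex subsets X with |X| = i and k(G[X]) = j.
Qcoeff : ∀ {n} → Graph n → ℕ → ℕ → ℕ
Qcoeff {n} G i j =
  length (filter (λ X → Data.Bool._≟_ ((∣ X ∣ ≡ᵇ i) ∧ (components G X ≡ᵇ j)) true) (allSubsets n))

SameQ : ∀ {n m} → Graph n → Graph m → Set
SameQ G H = ∀ i j → Qcoeff G i j ≡ Qcoeff H i j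

Complete : ∀ {n} → Graph n → Set
Complete {n} G = ∀ (u v : Fin n) → u ≢ v → adj G u v ≡ true

Disconnects : ∀ {n} → Graph n → Subset n → Set
Disconnects G S = 2 ≤ components G (∁ S)

IsConnectivity : ∀ {n} → Graph n → ℕ → Set
IsConnectivity {n} G c =
  (Complete G → c ≡ n ∸ 1) ×
  ((Complete G → ⊥) →
     Σ (Subset n) (λ S → Disconnects G S × ∣ S ∣ ≡ c) ×
     (∀ (S : Subset n) → Disconnects G S → c ≤ ∣ S ∣))

module Submission where

-- The coefficient of x^i y^j in Q(G;x,y) counts the vertex sets X with |X| = i
-- and k(G[X]) = j, so Q(G) = Q(H) says exactly that G and H realise the same
-- pairs (|X|, k(G[X])).  Three consequences suffice:
--   * G and H have the same order n (the pair (n, k(G)) is realised by V only);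
--   * S disconnects G iff k(G[V ∖ S]) ≥ 2, and |V ∖ S| = n - |S|, so G and H
--     have disconnecting sets of exactly the same sizes;
--   * a complete graph has no disconnected induced subgraph, hence no
--     disconnecting set, while a non-complete graph has one; so G is complete
--     iff H is.
-- If both are complete then c = n - 1 = d; otherwise c and d are the minima of
-- the same set of sizes.

open import Defs hiding (sym)
open import Data.Bool using (Bool; true; false; _∧_; _∨_; not)
import Data.Bool as Bool
open import Data.Bool.Properties using (∨-zeroʳ; ∧-zeroʳ; T-≡; T-∧)
open import Data.Nat using (ℕ; suc; _≤_; _∸_; z≤n; s≤s; _≡ᵇ_; _≤′_; ≤′-reflexive; ≤′-step)
open import Data.Nat.Properties using (≤-antisym; ≤-trans; <-irrefl; ≡ᵇ⇒≡; ≡⇒≡ᵇ; m∸[m∸n]≡n; ≤⇒≤′)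
open import Data.Fin using (Fin; _<_; _<?_)
import Data.Fin.Properties as Fin
open import Data.Fin.Subset using (Subset; inside; outside; ∣_∣; ∁; ⊤)
open import Data.Fin.Subset.Properties using (∣p∣≤n; ∣⊤∣≡n; ∣∁p∣≡n∸∣p∣)
open import Data.Vec using ([]; _∷_)
open import Data.List using (List; []; _∷_; map; foldr; filter; length; allFin)
open import Data.List.Membership.Propositional using (_∈_)
open import Data.List.Membership.Propositional.Properties
  using (∈-map⁺; ∈-++⁺ˡ; ∈-++⁺ʳ; ∈-allFin; ∈-filter⁺; ∈-filter⁻)
open import Data.List.Relation.Unary.Any using (here; there)
open import Data.List.Relation.Unary.All using (All; _∷_)
open import Data.List.Relation.Unary.All.Properties using (all-filter)
open import Data.List.Relation.Unary.AllPairs using (AllPairs; _∷_)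
import Data.List.Relation.Unary.AllPairs.Properties as AllPairs
open import Data.Empty using (⊥; ⊥-elim)
open import Data.Product using (Σ; ∃; _×_; _,_; proj₁; proj₂)
open import Function.Bundles using (_⇔_; Equivalence)
open import Level using (Level)
open import Relation.Nullary using (Dec; yes; no; ¬_; ¬?; _→-dec_)
open import Relation.Nullary.Decidable using (⌊_⌋; dec-true; isYes≗does)
open import Relation.Unary using (Pred; Decidable)
open import Relation.Binary.PropositionalEquality

private variable
  a p r : Level
  A : Set a
  n m : ℕ

length-pos⇒∈ : {ys : List A} → 1 ≤ length ys → ∃ λ y → y ∈ ys
length-pos⇒∈ {ys = y ∷ _} _ = y , here refl

∈⇒length-pos : {y : A} {ys : List A} → y ∈ ys → 1 ≤ length ys
∈⇒length-pos (here _)  = s≤s z≤n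
∈⇒length-pos (there _) = s≤s z≤n

filter-nonempty⇒∃ : {P : Pred A p} (P? : Decidable P) (xs : List A) →
                    1 ≤ length (filter P? xs) → ∃ P
filter-nonempty⇒∃ P? xs h with length-pos⇒∈ h
... | x , x∈ = x , proj₂ (∈-filter⁻ P? {xs = xs} x∈)

∈⇒filter-nonempty : {P : Pred A p} (P? : Decidable P) {x : A} {xs : List A} →
                    x ∈ xs → P x → 1 ≤ length (filter P? xs)
∈⇒filter-nonempty P? x∈ px = ∈⇒length-pos (∈-filter⁺ P? x∈ px)

pairwise-exclusive⇒length≤1 : {P : Pred A p} {R : A → A → Set r} {ys : List A} →
  AllPairs R ys → All P ys → (∀ x y → P x → P y → R x y → ⊥) → length ys ≤ 1
pairwise-exclusive⇒length≤1 {ys = []} _ _ _ = z≤n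
pairwise-exclusive⇒length≤1 {ys = _ ∷ []} _ _ _ = s≤s z≤n
pairwise-exclusive⇒length≤1 {ys = x ∷ y ∷ _} ((rxy ∷ _) ∷ _) (px ∷ py ∷ _) excl =
  ⊥-elim (excl x y px py rxy)

anyV-intro : (q : Fin n → Bool) (w : Fin n) → q w ≡ true → anyV q ≡ true
anyV-intro {n} q w qw = go (allFin n) (∈-allFin w)
  where
  go : (xs : List (Fin n)) → w ∈ xs → foldr _∨_ false (map q xs) ≡ true
  go (_ ∷ _)  (here refl) rewrite qw = refl
  go (x ∷ xs) (there w∈) rewrite go xs w∈ = ∨-zeroʳ (q x)

⌊⌋-true : {P : Set p} (P? : Dec P) → P → ⌊ P? ⌋ ≡ true
⌊⌋-true P? x = trans (isYes≗does P?) (dec-true P? x)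

∧-elimˡ : {b₁ b₂ : Bool} → b₁ ∧ b₂ ≡ true → b₁ ≡ true
∧-elimˡ {true} _ = refl

∈-allSubsets : (X : Subset n) → X ∈ allSubsets n
∈-allSubsets [] = here refl
∈-allSubsets (inside ∷ X) = ∈-++⁺ˡ (∈-map⁺ (inside ∷_) (∈-allSubsets X))
∈-allSubsets {suc n} (outside ∷ X) =
  ∈-++⁺ʳ (map (inside ∷_) (allSubsets n)) (∈-map⁺ (outside ∷_) (∈-allSubsets X))

counted : Graph n → ℕ → ℕ → Subset n → Bool
counted G i j X = (∣ X ∣ ≡ᵇ i) ∧ (components G X ≡ᵇ j)

counted⇔ : (G : Graph n) (i j : ℕ) (X : Subset n) →
           counted G i j X ≡ true ⇔ (∣ X ∣ ≡ i × components G X ≡ j)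
counted⇔ G i j X = record
  { to        = λ e → let (ti , tj) = Equivalence.to T-∧ (Equivalence.from T-≡ e)
                      in ≡ᵇ⇒≡ _ _ ti , ≡ᵇ⇒≡ _ _ tj
  ; from      = λ (ei , ej) → Equivalence.to T-≡ (Equivalence.from T-∧ (≡⇒≡ᵇ _ _ ei , ≡⇒≡ᵇ _ _ ej))
  ; to-cong   = λ { refl → refl }
  ; from-cong = λ { refl → refl }
  }

sameQ-realise : (G : Graph n) (H : Graph m) → SameQ G H → (X : Subset n) →
  Σ (Subset m) λ Y → ∣ Y ∣ ≡ ∣ X ∣ × components H Y ≡ components G X
sameQ-realise {m = m} G H sameQ X
  with filter-nonempty⇒∃ (λ Z → counted H i j Z Bool.≟ true) (allSubsets m)
         (subst (1 ≤_) (sameQ i j) countedG)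
  where
  i j : ℕ
  i = ∣ X ∣
  j = components G X
  countedG : 1 ≤ Qcoeff G i j
  countedG = ∈⇒filter-nonempty (λ Z → counted G i j Z Bool.≟ true) (∈-allSubsets X)
               (Equivalence.from (counted⇔ G i j X) (refl , refl))
... | Y , countedY = Y , Equivalence.to (counted⇔ H _ _ Y) countedY

sameQ-sym : (G : Graph n) (H : Graph m) → SameQ G H → SameQ H G
sameQ-sym G H sameQ i j = sym (sameQ i j)

-- Graphs with the same Q have the same order, realised by the full vertex set.
sameQ⇒order≤ : (G : Graph n) (H : Graph m) → SameQ G H → n ≤ m
sameQ⇒order≤ {n} {m} G H sameQ with sameQ-realise G H sameQ ⊤
... | Y , ∣Y∣≡∣⊤∣ , _ = subst (_≤ m) (trans ∣Y∣≡∣⊤∣ (∣⊤∣≡n n)) (∣p∣≤n Y)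

sameQ⇒sameOrder : (G : Graph n) (H : Graph m) → SameQ G H → n ≡ m
sameQ⇒sameOrder G H sameQ =
  ≤-antisym (sameQ⇒order≤ G H sameQ) (sameQ⇒order≤ H G (sameQ-sym G H sameQ))

∁-involutive : (X : Subset n) → ∁ (∁ X) ≡ X
∁-involutive [] = refl
∁-involutive (inside ∷ X)  = cong (inside ∷_) (∁-involutive X)
∁-involutive (outside ∷ X) = cong (outside ∷_) (∁-involutive X)

DisconnectingSize : Graph n → ℕ → Set
DisconnectingSize {n} G s = Σ (Subset n) λ S → Disconnects G S × ∣ S ∣ ≡ s

-- Graphs with the same Q have disconnecting sets of the same sizes: the
-- complement of a disconnecting set is realised in H by a set of the same size
-- and component count, whose complement disconnects H.
sameQ-disconnecting : (G : Graph n) (H : Graph m) → SameQ G H →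
                      ∀ {s} → DisconnectingSize G s → DisconnectingSize H s
sameQ-disconnecting {n} G H sameQ (S , disconnects , refl)
  with sameQ⇒sameOrder G H sameQ | sameQ-realise G H sameQ (∁ S)
... | refl | Y , ∣Y∣≡∣∁S∣ , kY≡k∁S = ∁ Y , disconnectsH , sizeT
  where
  disconnectsH : Disconnects H (∁ Y)
  disconnectsH rewrite ∁-involutive Y | kY≡k∁S = disconnects
  sizeT : ∣ ∁ Y ∣ ≡ ∣ S ∣
  sizeT = begin
    ∣ ∁ Y ∣           ≡⟨ ∣∁p∣≡n∸∣p∣ Y ⟩
    n ∸ ∣ Y ∣         ≡⟨ cong (n ∸_) (trans ∣Y∣≡∣∁S∣ (∣∁p∣≡n∸∣p∣ S)) ⟩
    n ∸ (n ∸ ∣ S ∣)   ≡⟨ m∸[m∸n]≡n (∣p∣≤n S) ⟩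
    ∣ S ∣             ∎
    where open ≡-Reasoning

-- A graph with a vertex has order at least 1 (so walks of length 1 are allowed).
inhabited⇒1≤n : Fin n → 1 ≤ n
inhabited⇒1≤n {suc _} _ = s≤s z≤n

module Reachability (G : Graph n) (X : Subset n) where

  reach-mono : ∀ {u v t s} → t ≤′ s → reach G X u t v ≡ true → reach G X u s v ≡ true
  reach-mono (≤′-reflexive refl) r = r
  reach-mono (≤′-step t≤′s) r rewrite reach-mono t≤′s r = refl

  adjacent⇒reach₁ : ∀ {u v} → u ∈ᵇ X ≡ true → v ∈ᵇ X ≡ true → adj G u v ≡ true →
                    reach G X u 1 v ≡ true
  adjacent⇒reach₁ {u} {v} u∈X v∈X uv = trans (cong (reach G X u 0 v ∨_) step) (∨-zeroʳ _)
    where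
    step : (v ∈ᵇ X) ∧ anyV (λ w → reach G X u 0 w ∧ adj G w v) ≡ true
    step rewrite v∈X =
      anyV-intro _ u (cong₂ _∧_ (cong₂ _∧_ u∈X (⌊⌋-true (u Fin.≟ u) refl)) uv)

  adjacent⇒connected : ∀ {u v} → u ∈ᵇ X ≡ true → v ∈ᵇ X ≡ true → adj G u v ≡ true →
                       connectedIn G X u v ≡ true
  adjacent⇒connected {u} u∈X v∈X uv =
    reach-mono (≤⇒≤′ (inhabited⇒1≤n u)) (adjacent⇒reach₁ u∈X v∈X uv)

  leastInComponent : Fin n → Bool
  leastInComponent v = (v ∈ᵇ X) ∧ not (anyV (λ w → ⌊ w <? v ⌋ ∧ connectedIn G X w v))

  connected⇒not-least : ∀ {u v} → u < v → connectedIn G X u v ≡ true →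
                        leastInComponent v ≡ false
  connected⇒not-least {u} {v} u<v conn
    rewrite anyV-intro (λ w → ⌊ w <? v ⌋ ∧ connectedIn G X w v) u
              (cong₂ _∧_ (⌊⌋-true (u <? v) u<v) conn) = ∧-zeroʳ (v ∈ᵇ X)

complete⇒components≤1 : (G : Graph n) → Complete G → (X : Subset n) → components G X ≤ 1
complete⇒components≤1 {n} G complete X =
  pairwise-exclusive⇒length≤1
    (AllPairs.filter⁺ least? (AllPairs.tabulate⁺-< (λ u<v → u<v)))
    (all-filter least? (allFin n))
    twoLeast⇒⊥
  where
  open Reachability G X
  least? : Decidable (λ v → leastInComponent v ≡ true)
  least? = λ v → leastInComponent v Bool.≟ true
  twoLeast⇒⊥ : ∀ u v → leastInComponent u ≡ true → leastInComponent v ≡ true → u < v → ⊥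
  twoLeast⇒⊥ u v leastU leastV u<v
    with trans (sym leastV) (connected⇒not-least u<v
           (adjacent⇒connected (∧-elimˡ leastU) (∧-elimˡ leastV)
             (complete u v (λ u≡v → Fin.<-irrefl u≡v u<v))))
  ... | ()

complete⇒no-disconnecting : (G : Graph n) → Complete G → ∀ {s} → ¬ DisconnectingSize G s
complete⇒no-disconnecting G complete (S , disconnects , _) =
  <-irrefl refl (≤-trans disconnects (complete⇒components≤1 G complete (∁ S)))

Complete? : (G : Graph n) → Dec (Complete G)
Complete? G = Fin.all? λ u → Fin.all? λ v → ¬? (u Fin.≟ v) →-dec (adj G u v Bool.≟ true)

-- Q determines completeness (given that c(H) exists, a non-complete H has a
-- disconnecting set, which would transfer to the complete graph G).
sameQ-complete : (G : Graph n) (H : Graph m) (d : ℕ) → SameQ G H →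
                 IsConnectivity H d → Complete G → Complete H
sameQ-complete G H d sameQ (_ , minimumH) completeG with Complete? H
... | yes completeH = completeH
... | no ¬completeH = ⊥-elim (complete⇒no-disconnecting G completeG
        (sameQ-disconnecting H G (sameQ-sym G H sameQ) (proj₁ (minimumH ¬completeH))))

sameQ-minimum≤ : (G : Graph n) (H : Graph m) → SameQ G H → ∀ {c d} →
                 (∀ S → Disconnects G S → c ≤ ∣ S ∣) → DisconnectingSize H d → c ≤ d
sameQ-minimum≤ G H sameQ minimal disconnectingH
  with sameQ-disconnecting H G (sameQ-sym G H sameQ) disconnectingH
... | S , disconnects , refl = minimal S disconnects

theorem3p2 : ∀ {n m : ℕ} (G : Graph n) (H : Graph m) (c d : ℕ) →
    SameQ G H → IsConnectivity G c → IsConnectivity H d → c ≡ d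
theorem3p2 {n} {m} G H c d sameQ connG@(completeG⇒c , minimumG) connH@(completeH⇒d , minimumH)
  with Complete? G
... | yes completeG = begin
  c                   ≡⟨ completeG⇒c completeG ⟩
  n ∸ 1               ≡⟨ cong (_∸ 1) (sameQ⇒sameOrder G H sameQ) ⟩
  m ∸ 1               ≡⟨ sym (completeH⇒d (sameQ-complete G H d sameQ connH completeG)) ⟩
  d                   ∎
  where open ≡-Reasoning
... | no ¬completeG =
  ≤-antisym (sameQ-minimum≤ G H sameQ (proj₂ (minimumG ¬completeG)) (proj₁ (minimumH ¬completeH)))
            (sameQ-minimum≤ H G sameQ' (proj₂ (minimumH ¬completeH)) (proj₁ (minimumG ¬completeG)))
  where
  sameQ' : SameQ H G
  sameQ' = sameQ-sym G H sameQ
  ¬completeH : ¬ Complete H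
  ¬completeH completeH = ¬completeG (sameQ-complete H G c sameQ' connG completeH)
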